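{- Let $\langle W,\leq,\mathbb{I},\mathbb{L},\mathbb{R}\rangle$ be a $\mathtt{SkMBiCA}$ frame, and let $\mathcal{P}_{\downarrow}(W)$ be the set of downward closed subsets of $W$, viewed as a thin category ordered by inclusion, with unit object $\mathbb{I}$ and operations, for $A,B\in\mathcal{P}_{\downarrow}(W)$: $A\otimes^{\mathsf{L}} B = \{c : \exists a\in A, b\in B, \mathbb{L}abc\}$, $A\multimap^{\mathsf{L}} B = \{c : \forall a\in A, b\in W, \mathbb{L}cab\Rightarrow b\in B\}$, $A\otimes^{\mathsf{R}} B = \{c : \exists a\in A, b\in B, \mathbb{R}abc\}$, $A\multimap^{\mathsf{R}} B = \{c : \forall a\in A, b\in W, \mathbb{R}cab\Rightarrow b\in B\}$. Then $(\mathcal{P}_{\downarrow}(W),\subseteq)$ with this structure is a thin skew monoidal bi-closed category.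
   Context: A $\mathtt{SkMBiCA}$ frame is $\langle W,\leq,\mathbb{I},\mathbb{L},\mathbb{R}\rangle$ with $W$ a set, $\le$ a preorder on $W$, $\mathbb{I}\subseteq W$ downward closed, $\mathbb{L},\mathbb{R}\subseteq W^3$ upward closed in their first two arguments and downward closed in their third, satisfying: ($\mathbb{LR}$-reverse) $\mathbb{L}abc\iff\mathbb{R}bac$; (LSA) if $\mathbb{L}abx$ and $\mathbb{L}xcd$ then there is $y$ with $\mathbb{L}bcy$ and $\mathbb{L}ayd$; (LSLU) for $a,b\in W$, $e\in\mathbb{I}$, $\mathbb{L}eab$ implies $b\le a$; (LSRU) for every $a\in W$ there is $e\in\mathbb{I}$ with $\mathbb{L}aea$. A skew monoidal bi-closed category is a category with an object $\mathsf{I}$ and functors $\otimes^{\mathsf{L}},\otimes^{\mathsf{R}}:\mathbb{C}\times\mathbb{C}\to\mathbb{C}$, $\multimap^{\mathsf{L}},\multimap^{\mathsf{R}}:\mathbb{C}^{op}\times\mathbb{C}\to\mathbb{C}$ with adjunctions ${ - }\otimes^{\mathsf{L}} B\dashv B\multimap^{\mathsf{L}}{ - }$ and ${ - }\otimes^{\mathsf{R}} B\dashv B\multimap^{\mathsf{R}}{ - }$, such that $(\mathsf{I},\otimes^{\mathsf{L}},\multimap^{\mathsf{L}})$ is left skew monoidal closed (natural transformations $\lambda_A:\mathsf{I}\otimes^{\mathsf{L}} A\to A$, $\rho_A: A\to A\otimes^{\mathsf{L}}\mathsf{I}$, $\alpha_{A,B,C}:(A\otimes^{\mathsf{L}} B)\otimes^{\mathsf{L}}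 C\to A\otimes^{\mathsf{L}}(B\otimes^{\mathsf{L}} C)$ satisfying Mac Lane's five coherence equations), together with a natural isomorphism $\gamma: A\otimes^{\mathsf{L}} B\to B\otimes^{\mathsf{R}} A$ (the right skew structure being induced from the left one via $\gamma$). In a thin category (a preorder) all equations between morphisms hold automatically, so for $(\mathcal{P}_{\downarrow}(W),\subseteq)$ this amounts to: the operations are monotone ($\otimes$ in both arguments, $\multimap$ antitone in the first and monotone in the second), $A\otimes^{\mathsf{L}} B\subseteq C\iff A\subseteq B\multimap^{\mathsf{L}} C$, $A\otimes^{\mathsf{R}} B\subseteq C\iff A\subseteq B\multimap^{\mathsf{R}} C$, $\mathbb{I}\otimes^{\mathsf{L}} A\subseteq A$, $A\subseteq A\otimes^{\mathsf{L}}\mathbb{I}$, $(A\otimes^{\mathsf{L}} B)\otimes^{\mathsf{L}} C\subseteq A\otimes^{\mathsf{L}}(B\otimes^{\mathsf{L}} C)$, and $A\otimes^{\mathsf{L}} B = B\otimes^{\mathsf{R}} A$, for all downward closed $A,B,C$. -}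

module Defs where

open import Level using (Level; suc; _⊔_)
open import Data.Product using (Σ; ∃; _×_; _,_)
open import Relation.Binary using (Rel; IsPreorder)
open import Relation.Binary.PropositionalEquality using (_≡_)
open import Relation.Unary using (Pred)

record Frame (ℓ : Level) : Set (suc ℓ) where
  field
    W          : Set ℓ
    _≤_        : Rel W ℓ
    isPreorder : IsPreorder _≡_ _≤_
    𝕀          : Pred W ℓ
    𝕃          : W → W → W → Set ℓ
    ℝ          : W → W → W → Set ℓ
    𝕀-down     : ∀ {x y} → y ≤ x → 𝕀 x → 𝕀 y
    𝕃-up₁      : ∀ {a a' b c} → a ≤ a' → 𝕃 a b c → 𝕃 a' b c
    𝕃-up₂      : ∀ {a b b' c} → b ≤ b' → 𝕃 a b c → 𝕃 a b' c
    𝕃-down₃    : ∀ {a b c c'} → c' ≤ c → 𝕃 a b c → 𝕃 a b c'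
    ℝ-up₁      : ∀ {a a' b c} → a ≤ a' → ℝ a b c → ℝ a' b c
    ℝ-up₂      : ∀ {a b b' c} → b ≤ b' → ℝ a b c → ℝ a b' c
    ℝ-down₃    : ∀ {a b c c'} → c' ≤ c → ℝ a b c → ℝ a b c'
    𝕃⇒ℝ        : ∀ {a b c} → 𝕃 a b c → ℝ b a c
    ℝ⇒𝕃        : ∀ {a b c} → ℝ b a c → 𝕃 a b c
    LSA        : ∀ {a b c d x} → 𝕃 a b x → 𝕃 x c d → ∃ λ y → 𝕃 b c y × 𝕃 a y d
    LSLU       : ∀ {a b e} → 𝕀 e → 𝕃 e a b → b ≤ a
    LSRU       : ∀ a → ∃ λ e → 𝕀 e × 𝕃 a e a

module _ {ℓ : Level} (F : Frame ℓ) where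
  open Frame F

  DownClosed : Pred W ℓ → Set ℓ
  DownClosed A = ∀ {x y} → y ≤ x → A x → A y

  record DownSet : Set (suc ℓ) where
    constructor downset
    field
      carrier : Pred W ℓ
      closed  : DownClosed carrier
  open DownSet public

  𝕀↓ : DownSet
  𝕀↓ = downset 𝕀 𝕀-down

  _⊆↓_ : DownSet → DownSet → Set ℓ
  A ⊆↓ B = ∀ {x} → carrier A x → carrier B x

  _⊗L_ : DownSet → DownSet → Pred W ℓ
  (A ⊗L B) c = Σ W λ a → Σ W λ b → carrier A a × carrier B b × 𝕃 a b c

  _⊸L_ : DownSet → DownSet → Pred W ℓ
  (A ⊸L B) c = ∀ a b → carrier A a → 𝕃 c a b → carrier B b

  _⊗R_ : DownSet → DownSet → Pred W ℓ
  (A ⊗R B) c = Σ W λ a → Σ W λ b → carrier A a × carrier B b × ℝ a b c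

  _⊸R_ : DownSet → DownSet → Pred W ℓ
  (A ⊸R B) c = ∀ a b → carrier A a → ℝ c a b → carrier B b

  -- "(𝒫↓(W), ⊆) with 𝕀, ⊗L, ⊸L, ⊗R, ⊸R is a thin skew monoidal bi-closed
  -- category", spelled out as in the context (in a thin category all
  -- equations between morphisms hold automatically).
  record IsThinSkMBiClosed : Set (suc ℓ) where
    field
      ⊗L-closed : ∀ A B → DownClosed (A ⊗L B)
      ⊸L-closed : ∀ A B → DownClosed (A ⊸L B)
      ⊗R-closed : ∀ A B → DownClosed (A ⊗R B)
      ⊸R-closed : ∀ A B → DownClosed (A ⊸R B)
    _⊗L↓_ : DownSet → DownSet → DownSet
    A ⊗L↓ B = downset (A ⊗L B) (⊗L-closed A B)
    _⊸L↓_ : DownSet → DownSet → DownSet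
    A ⊸L↓ B = downset (A ⊸L B) (⊸L-closed A B)
    _⊗R↓_ : DownSet → DownSet → DownSet
    A ⊗R↓ B = downset (A ⊗R B) (⊗R-closed A B)
    _⊸R↓_ : DownSet → DownSet → DownSet
    A ⊸R↓ B = downset (A ⊸R B) (⊸R-closed A B)
    field
      ⊗L-mono : ∀ {A A' B B'} → A ⊆↓ A' → B ⊆↓ B' → (A ⊗L↓ B) ⊆↓ (A' ⊗L↓ B')
      ⊗R-mono : ∀ {A A' B B'} → A ⊆↓ A' → B ⊆↓ B' → (A ⊗R↓ B) ⊆↓ (A' ⊗R↓ B')
      ⊸L-mono : ∀ {A A' B B'} → A' ⊆↓ A → B ⊆↓ B' → (A ⊸L↓ B) ⊆↓ (A' ⊸L↓ B')
      ⊸R-mono : ∀ {A A' B B'} → A' ⊆↓ A → B ⊆↓ B' → (A ⊸R↓ B) ⊆↓ (A' ⊸R↓ B')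
      adjL⇒ : ∀ {A B C} → (A ⊗L↓ B) ⊆↓ C → A ⊆↓ (B ⊸L↓ C)
      adjL⇐ : ∀ {A B C} → A ⊆↓ (B ⊸L↓ C) → (A ⊗L↓ B) ⊆↓ C
      adjR⇒ : ∀ {A B C} → (A ⊗R↓ B) ⊆↓ C → A ⊆↓ (B ⊸R↓ C)
      adjR⇐ : ∀ {A B C} → A ⊆↓ (B ⊸R↓ C) → (A ⊗R↓ B) ⊆↓ C
      λ↓ : ∀ A → (𝕀↓ ⊗L↓ A) ⊆↓ A
      ρ↓ : ∀ A → A ⊆↓ (A ⊗L↓ 𝕀↓)
      α↓ : ∀ A B C → ((A ⊗L↓ B) ⊗L↓ C) ⊆↓ (A ⊗L↓ (B ⊗L↓ C))
      γ↓  : ∀ A B → (A ⊗L↓ B) ⊆↓ (B ⊗R↓ A)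
      γ⁻¹ : ∀ A B → (B ⊗R↓ A) ⊆↓ (A ⊗L↓ B)

{-# OPTIONS --safe #-}
module Submission where

open import Level using (Level)
open import Data.Product using (Σ; _×_; _,_)
open import Relation.Binary using (Rel)
open import Relation.Unary using (Pred; _⊆_)
open import Defs

-- Every structure map of the thin category is the image of one frame
-- condition: the closure properties of 𝕃 and ℝ make the operations land in
-- down-sets, the adjunctions hold for an arbitrary ternary relation
-- (residuation), and LSLU, LSRU, LSA and LR-reverse give λ, ρ, α and γ.

module Residuation {ℓ : Level} {W : Set ℓ} (_≤_ : Rel W ℓ) (T : W → W → W → Set ℓ) where

  infixr 7 _⊗_
  infixr 6 _⊸_

  _⊗_ : Pred W ℓ → Pred W ℓ → Pred W ℓ
  (P ⊗ Q) c = Σ W λ a → Σ W λ b → P a × Q b × T a b c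

  _⊸_ : Pred W ℓ → Pred W ℓ → Pred W ℓ
  (P ⊸ Q) c = ∀ a b → P a → T c a b → Q b

  ⊗-downClosed : (∀ {a b c c'} → c' ≤ c → T a b c → T a b c') →
                 ∀ P Q {c c'} → c' ≤ c → (P ⊗ Q) c → (P ⊗ Q) c'
  ⊗-downClosed T-down₃ P Q c'≤c (a , b , Pa , Qb , Tabc) = a , b , Pa , Qb , T-down₃ c'≤c Tabc

  ⊸-downClosed : (∀ {a a' b c} → a ≤ a' → T a b c → T a' b c) →
                 ∀ P Q {c c'} → c' ≤ c → (P ⊸ Q) c → (P ⊸ Q) c'
  ⊸-downClosed T-up₁ P Q c'≤c P⊸Qc a b Pa Tc'ab = P⊸Qc a b Pa (T-up₁ c'≤c Tc'ab)

  ⊗-mono : ∀ {P P' Q Q'} → P ⊆ P' → Q ⊆ Q' → P ⊗ Q ⊆ P' ⊗ Q'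
  ⊗-mono P⊆P' Q⊆Q' (a , b , Pa , Qb , Tabc) = a , b , P⊆P' Pa , Q⊆Q' Qb , Tabc

  ⊸-mono : ∀ {P P' Q Q'} → P' ⊆ P → Q ⊆ Q' → (P ⊸ Q) ⊆ (P' ⊸ Q')
  ⊸-mono P'⊆P Q⊆Q' P⊸Qc a b P'a Tcab = Q⊆Q' (P⊸Qc a b (P'⊆P P'a) Tcab)

  ⊗-curry : ∀ {P Q S} → P ⊗ Q ⊆ S → P ⊆ (Q ⊸ S)
  ⊗-curry P⊗Q⊆S Pc a b Qa Tcab = P⊗Q⊆S (_ , a , Pc , Qa , Tcab)

  ⊗-uncurry : ∀ {P Q S} → P ⊆ (Q ⊸ S) → P ⊗ Q ⊆ S
  ⊗-uncurry P⊆Q⊸S (a , b , Pa , Qb , Tabc) = P⊆Q⊸S Pa b _ Qb Tabc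

module SkewMonoidal {ℓ : Level} (F : Frame ℓ) where

  open Frame F
  module L = Residuation _≤_ 𝕃
  module R = Residuation _≤_ ℝ
  open L using (_⊗_)

  ⊗-unitorˡ : ∀ {P} → DownClosed F P → 𝕀 ⊗ P ⊆ P
  ⊗-unitorˡ P-down (e , a , 𝕀e , Pa , 𝕃eac) = P-down (LSLU 𝕀e 𝕃eac) Pa

  ⊗-unitorʳ : ∀ {P} → P ⊆ P ⊗ 𝕀
  ⊗-unitorʳ {x = a} Pa with LSRU a
  ... | e , 𝕀e , 𝕃aea = a , e , Pa , 𝕀e , 𝕃aea

  ⊗-associator : ∀ {P Q S} → (P ⊗ Q) ⊗ S ⊆ P ⊗ (Q ⊗ S)
  ⊗-associator (x , c , (a , b , Pa , Qb , 𝕃abx) , Sc , 𝕃xcd) with LSA 𝕃abx 𝕃xcd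
  ... | y , 𝕃bcy , 𝕃ayd = a , y , Pa , (b , c , Qb , Sc , 𝕃bcy) , 𝕃ayd

  ⊗-swap : ∀ {P Q} → P ⊗ Q ⊆ Q R.⊗ P
  ⊗-swap (a , b , Pa , Qb , 𝕃abc) = b , a , Qb , Pa , 𝕃⇒ℝ 𝕃abc

  ⊗-unswap : ∀ {P Q} → Q R.⊗ P ⊆ P ⊗ Q
  ⊗-unswap (b , a , Qb , Pa , ℝbac) = a , b , Pa , Qb , ℝ⇒𝕃 ℝbac

mainTheorem11 : ∀ {ℓ : Level} (F : Frame ℓ) → IsThinSkMBiClosed F
mainTheorem11 F = record
  { ⊗L-closed = λ A B → L.⊗-downClosed 𝕃-down₃ (carrier A) (carrier B)
  ; ⊸L-closed = λ A B → L.⊸-downClosed 𝕃-up₁ (carrier A) (carrier B)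
  ; ⊗R-closed = λ A B → R.⊗-downClosed ℝ-down₃ (carrier A) (carrier B)
  ; ⊸R-closed = λ A B → R.⊸-downClosed ℝ-up₁ (carrier A) (carrier B)
  ; ⊗L-mono = L.⊗-mono
  ; ⊗R-mono = R.⊗-mono
  ; ⊸L-mono = L.⊸-mono
  ; ⊸R-mono = R.⊸-mono
  ; adjL⇒ = L.⊗-curry
  ; adjL⇐ = L.⊗-uncurry
  ; adjR⇒ = R.⊗-curry
  ; adjR⇐ = R.⊗-uncurry
  ; λ↓ = λ A → ⊗-unitorˡ (closed A)
  ; ρ↓ = λ A → ⊗-unitorʳ
  ; α↓ = λ A B C → ⊗-associator
  ; γ↓ = λ A B → ⊗-swap
  ; γ⁻¹ = λ A B → ⊗-unswap
  }
  where
    open Frame F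
    open SkewMonoidal F
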